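{- Let $G=(V,E)$ be a finite simple undirected graph and let $E'\subseteq E$ be a set of edges (the "uncovered" edges). Define the graph $G'_{VCC}=(V'_{VCC},E'_{VCC})$ by $V'_{VCC}=\{v_{xy}\mid \{x,y\}\in E'\}$ (one vertex per edge of $E'$) and $E'_{VCC}=\{\{v_{xy},v_{wz}\}\mid \{x,y\},\{w,z\}\in E' \text{ distinct and } \{x,y\}\cup\{w,z\} \text{ is a clique in } G\}$. If $C'$ is a clique in $G'_{VCC}$, then $C=\bigcup_{v_{xy}\in C'}\{x,y\}$ is a clique in $G$ that covers $|C'|$ edges of $E'$ (namely the edges $\{x,y\}$ with $v_{xy}\in C'$).
   Context: A clique is a set of pairwise adjacent vertices. A clique $C$ in $G$ covers an edge $\{u,v\}$ if $\{u,v\}\subseteq C$. -}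

module Defs where

open import Data.Nat using (ℕ)
open import Data.Fin using (Fin; _<_)
open import Data.Product using (_×_; _,_; Σ; ∃; proj₁; proj₂)
open import Data.Sum using (_⊎_; inj₁; inj₂)
open import Data.Empty using (⊥)
open import Relation.Nullary using (¬_)
open import Relation.Binary.PropositionalEquality using (_≡_; _≢_; refl)
open import Function.Definitions using (Injective)

record Graph (n : ℕ) : Set₁ where
  field
    Adj    : Fin n → Fin n → Set
    sym    : ∀ {u v} → Adj u v → Adj v u
    irrefl : ∀ {u} → ¬ Adj u u
open Graph public

IsClique : ∀ {n} → Graph n → (Fin n → Set) → Set
IsClique G C = ∀ u v → C u → C v → u ≢ v → Adj G u v

-- An (unordered) edge {x,y} is represented canonically as the pair (x , y) with x < y.
Pair : ℕ → Set
Pair n = Fin n × Fin n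

Endpoint : ∀ {n} → Fin n → Pair n → Set
Endpoint x (a , b) = (x ≡ a) ⊎ (x ≡ b)

Covers : ∀ {n} → (Fin n → Set) → Pair n → Set
Covers C (a , b) = C a × C b

record EdgeSubset {n : ℕ} (G : Graph n) : Set where
  field
    m        : ℕ
    e        : Fin m → Pair n
    ordered  : ∀ i → proj₁ (e i) < proj₂ (e i)
    inE      : ∀ i → Adj G (proj₁ (e i)) (proj₂ (e i))
    distinct : Injective _≡_ _≡_ e
open EdgeSubset public

-- Adjacency of G'_VCC: vertices are (indices of) edges of E';
-- v_i ~ v_j iff the edges are distinct and their union is a clique in G.
VCCAdj : ∀ {n} (G : Graph n) (E' : EdgeSubset G) → Fin (m E') → Fin (m E') → Set
VCCAdj G E' i j =
  (i ≢ j) × IsClique G (λ x → Endpoint x (e E' i) ⊎ Endpoint x (e E' j))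

VCC : ∀ {n} (G : Graph n) (E' : EdgeSubset G) → Graph (m E')
VCC G E' = record
  { Adj    = VCCAdj G E'
  ; sym    = λ { (i≢j , cl) → (λ eq → i≢j (symm eq))
                , (λ u v cu cv u≢v → cl u v (swap cu) (swap cv) u≢v) }
  ; irrefl = λ { (i≢i , _) → i≢i refl }
  }
  where
    symm : ∀ {A : Set} {a b : A} → a ≡ b → b ≡ a
    symm refl = refl
    swap : ∀ {A B : Set} → A ⊎ B → B ⊎ A
    swap (inj₁ a) = inj₂ a
    swap (inj₂ b) = inj₁ b

UnionEndpoints : ∀ {n} {G : Graph n} (E' : EdgeSubset G) → (Fin (m E') → Set) → Fin n → Set
UnionEndpoints E' C' x = ∃ λ i → C' i × Endpoint x (e E' i)

{-# OPTIONS --safe #-}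
module Submission where

-- Two vertices of ⋃ C' lie on edges e i and e j with i, j ∈ C'. If i = j they are the two
-- endpoints of an edge of G; otherwise v_i ~ v_j in G'_VCC, which says exactly that e i ∪ e j
-- is a clique. The covered edges are the e i with i ∈ C', and there are ∣ C' ∣ of them
-- because e is injective.

open import Defs
open import Data.Nat using (suc)
open import Data.Fin using (Fin; zero; suc; _≟_)
open import Data.Fin.Properties using (0≢1+n; suc-injective)
open import Data.Fin.Subset using (Subset; _∈_; ∣_∣)
open import Data.Vec using ([]; _∷_; here; there)
open import Data.Bool using (true; false)
open import Data.List using (List; []; _∷_; length; map)
open import Data.List.Properties using (length-map)
open import Data.List.Relation.Unary.All as All using (All; []; _∷_)
import Data.List.Relation.Unary.All.Properties as All
open import Data.List.Relation.Unary.AllPairs using ([]; _∷_)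
open import Data.List.Relation.Unary.Unique.Propositional using (Unique)
import Data.List.Relation.Unary.Unique.Propositional.Properties as Unique
open import Data.Product using (_×_; Σ; ∃; _,_; proj₂)
open import Data.Sum using (inj₁; inj₂)
open import Data.Empty using (⊥-elim)
open import Relation.Nullary using (yes; no)
open import Relation.Binary.PropositionalEquality using (_≡_; _≢_; refl; cong; trans)

toList : ∀ {k} → Subset k → List (Fin k)
toList []          = []
toList (true ∷ p)  = zero ∷ map suc (toList p)
toList (false ∷ p) = map suc (toList p)

length-toList : ∀ {k} (p : Subset k) → length (toList p) ≡ ∣ p ∣
length-toList []          = refl
length-toList (true ∷ p)  = cong suc (trans (length-map suc (toList p)) (length-toList p))
length-toList (false ∷ p) = trans (length-map suc (toList p)) (length-toList p)

toList-⊆ : ∀ {k} (p : Subset k) → All (_∈ p) (toList p)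
toList-⊆ []          = []
toList-⊆ (true ∷ p)  = here ∷ All.map⁺ (All.map there (toList-⊆ p))
toList-⊆ (false ∷ p) = All.map⁺ (All.map there (toList-⊆ p))

toList-unique : ∀ {k} (p : Subset k) → Unique (toList p)
toList-unique []          = []
toList-unique (true ∷ p)  =
  All.map⁺ (All.universal (λ _ → 0≢1+n) (toList p)) ∷ Unique.map⁺ suc-injective (toList-unique p)
toList-unique (false ∷ p) = Unique.map⁺ suc-injective (toList-unique p)

endpoints-adjacent : ∀ {n} (G : Graph n) {a b u v : Fin n} → Adj G a b →
                     Endpoint u (a , b) → Endpoint v (a , b) → u ≢ v → Adj G u v
endpoints-adjacent G ab (inj₁ refl) (inj₁ refl) u≢v = ⊥-elim (u≢v refl)
endpoints-adjacent G ab (inj₁ refl) (inj₂ refl) u≢v = ab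
endpoints-adjacent G ab (inj₂ refl) (inj₁ refl) u≢v = sym G ab
endpoints-adjacent G ab (inj₂ refl) (inj₂ refl) u≢v = ⊥-elim (u≢v refl)

module _ {n} {G : Graph n} (E' : EdgeSubset G) (C' : Fin (m E') → Set) where

  unionEndpoints-isClique : IsClique (VCC G E') C' → IsClique G (UnionEndpoints E' C')
  unionEndpoints-isClique C'-clique u v (i , i∈C' , u∈eᵢ) (j , j∈C' , v∈eⱼ) u≢v with i ≟ j
  ... | yes refl = endpoints-adjacent G (inE E' i) u∈eᵢ v∈eⱼ u≢v
  ... | no i≢j   = proj₂ (C'-clique i j i∈C' j∈C' i≢j) u v (inj₁ u∈eᵢ) (inj₂ v∈eⱼ) u≢v

  unionEndpoints-covers : ∀ i → C' i → Covers (UnionEndpoints E' C') (e E' i)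
  unionEndpoints-covers i i∈C' = (i , i∈C' , inj₁ refl) , (i , i∈C' , inj₂ refl)

mainTheorem2 : ∀ {n} (G : Graph n) (E' : EdgeSubset G) (C' : Subset (m E'))
    → IsClique (VCC G E') (_∈ C')
    → IsClique G (UnionEndpoints E' (_∈ C'))
      × (∀ i → i ∈ C' → Covers (UnionEndpoints E' (_∈ C')) (e E' i))
      × Σ (List (Pair n)) (λ L → length L ≡ ∣ C' ∣ × Unique L
          × All (λ p → (∃ λ i → i ∈ C' × e E' i ≡ p)
                       × Covers (UnionEndpoints E' (_∈ C')) p) L)
mainTheorem2 G E' C' C'-clique =
  unionEndpoints-isClique E' (_∈ C') C'-clique ,
  covers ,
  map (e E') (toList C') ,
  trans (length-map (e E') (toList C')) (length-toList C') ,
  Unique.map⁺ (distinct E') (toList-unique C') ,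
  All.map⁺ (All.map (λ {i} i∈C' → (i , i∈C' , refl) , covers i i∈C') (toList-⊆ C'))
  where
  covers : ∀ i → i ∈ C' → Covers (UnionEndpoints E' (_∈ C')) (e E' i)
  covers = unionEndpoints-covers E' (_∈ C')
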